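{- Let $2\le i\le n$. The map $\epsilon_i\colon J_n\to J_n^{i,n}$ defined on generators by $\epsilon_i(s_{p,q})=1$ if $q-p+1<i$ and $\epsilon_i(s_{p,q})=s_{p,q}$ if $q-p+1\ge i$ is a well-defined surjective group homomorphism, the homomorphism $\iota_i\colon J_n^{i,n}\to J_n$, $s_{p,q}\mapsto s_{p,q}$, is a section of it, and the kernel of $\epsilon_i$ equals the normal closure $N$ in $J_n$ of the subgroup generated by all $s_{p,q}$ with $q-p+1\le i-1$ (this subgroup is the image of $J_n^{2,i-1}$, and is trivial when $i=2$). Thus there is a split exact sequence $1\to N\to J_n\to J_n^{i,n}\to 1$, and $J_n\cong N\rtimes J_n^{i,n}$.
   Context: For $n \ge 2$, the cactus group $J_n$ is the group with generators $s_{p,q}$ for $1 \le p < q \le n$ and relations: (j1) $s_{p,q}^2 = 1$; (j2) $s_{p,q}s_{m,r} = s_{m,r}s_{p,q}$ whenever $[p,q]\cap[m,r]=\emptyset$; (j3) $s_{p,q}s_{m,r} = s_{p+q-r,\,p+q-m}\,s_{p,q}$ whenever $[m,r]\subset[p,q]$. For $2\le i\le j\le n$, $J_n^{i,j}$ is the group with generators $s_{p,q}$ for $1\le p<q\le n$ with $i \le q-p+1 \le j$, and as relations all the relations (j1)–(j3) that involve only these generators. -}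

module Defs where

open import Data.Nat using (ℕ; zero; suc; _+_; _∸_; _≤_; _<_; s≤s; _≤?_)
open import Data.Nat.Properties using (m<n⇒0<n∸m)
open import Data.Bool using (Bool; true; false; not)
open import Data.List using (List; []; _∷_; _++_; map; reverse; concatMap)
open import Data.Product using (_×_; _,_)
open import Data.Sum using (_⊎_)
open import Relation.Nullary using (yes; no)
open import Relation.Binary.PropositionalEquality using (_≡_)

-- (g , true) stands for g, (g , false) for g⁻¹
Letter : Set → Set
Letter G = G × Bool

Word : Set → Set
Word G = List (Letter G)

invL : {G : Set} → Letter G → Letter G
invL (g , b) = (g , not b)

invW : {G : Set} → Word G → Word G
invW w = reverse (map invL w)

pos : {G : Set} → G → Letter G
pos g = (g , true)

data Eqv {G : Set} (R : Word G → Word G → Set) : Word G → Word G → Set where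
  rel    : ∀ {u v} → R u v → Eqv R u v
  refl'  : ∀ {u} → Eqv R u u
  sym'   : ∀ {u v} → Eqv R u v → Eqv R v u
  trans' : ∀ {u v w} → Eqv R u v → Eqv R v w → Eqv R u w
  cancel : ∀ (x : Letter G) → Eqv R (x ∷ invL x ∷ []) []
  ctx    : ∀ (a b : Word G) {u v} → Eqv R u v → Eqv R (a ++ u ++ b) (a ++ v ++ b)

record Gen (n i j : ℕ) : Set where
  constructor gen
  field
    p     : ℕ
    q     : ℕ
    1≤p   : 1 ≤ p
    p<q   : p < q
    q≤n   : q ≤ n
    i≤len : i ≤ suc (q ∸ p)
    len≤j : suc (q ∸ p) ≤ j

open Gen public

len : ∀ {n i j} → Gen n i j → ℕ
len g = suc (q g ∸ p g)

data RelJ {n i j : ℕ} : Word (Gen n i j) → Word (Gen n i j) → Set where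
  j1 : ∀ (a : Gen n i j) → RelJ (pos a ∷ pos a ∷ []) []
  j2 : ∀ (a b : Gen n i j) → (q a < p b ⊎ q b < p a) →
       RelJ (pos a ∷ pos b ∷ []) (pos b ∷ pos a ∷ [])
  j3 : ∀ (a b c : Gen n i j) → p a ≤ p b → q b ≤ q a →
       p c ≡ (p a + q a) ∸ q b → q c ≡ (p a + q a) ∸ p b →
       RelJ (pos a ∷ pos b ∷ []) (pos c ∷ pos a ∷ [])


EqJ : (n i j : ℕ) → Word (Gen n i j) → Word (Gen n i j) → Set
EqJ n i j = Eqv (RelJ {n} {i} {j})

-- The cactus group J_n is J_n^{2,n} (all generators, all relations).
GenJ : ℕ → Set
GenJ n = Gen n 2 n

EqJn : (n : ℕ) → Word (GenJ n) → Word (GenJ n) → Set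
EqJn n = EqJ n 2 n

εL : ∀ {n} (i : ℕ) → Letter (GenJ n) → Word (Gen n i n)
εL i (g , b) with i ≤? len g
... | yes h = (gen (p g) (q g) (1≤p g) (p<q g) (q≤n g) h (len≤j g) , b) ∷ []
... | no _  = []

ε : ∀ {n} (i : ℕ) → Word (GenJ n) → Word (Gen n i n)
ε i w = concatMap (εL i) w

ιG : ∀ {n i} → Gen n i n → GenJ n
ιG g = gen (p g) (q g) (1≤p g) (p<q g) (q≤n g) (s≤s (m<n⇒0<n∸m (p<q g))) (len≤j g)

ι : ∀ {n i} → Word (Gen n i n) → Word (GenJ n)
ι w = map (λ { (g , b) → (ιG g , b) }) w

data NC (n i : ℕ) : Word (GenJ n) → Set where
  nc-gen  : ∀ (g : GenJ n) → len g ≤ i ∸ 1 → NC n i (pos g ∷ [])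
  nc-one  : NC n i []
  nc-mul  : ∀ {u v} → NC n i u → NC n i v → NC n i (u ++ v)
  nc-inv  : ∀ {u} → NC n i u → NC n i (invW u)
  nc-conj : ∀ {u} (w : Word (GenJ n)) → NC n i u → NC n i (w ++ u ++ invW w)
  nc-resp : ∀ {u v} → EqJn n u v → NC n i u → NC n i v

{-# OPTIONS --safe #-}

-- ε_i only deletes letters, and a relation of J_n either survives it intact or
-- collapses to a trivial one, because (j3) preserves interval lengths. For the
-- kernel, induct along a word w to show w · ι(ε w)⁻¹ ∈ N: a short first letter
-- multiplies by an element of N, a long one conjugates. Hence ε w = 1 forces w ∈ N.
module Submission where

open import Defs
open import Data.Nat using (ℕ; zero; suc; _+_; _∸_; _≤_; s≤s; z≤n; _≤?_)
open import Data.Nat.Properties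
  using (≤-irrelevant; ≤-trans; m≤n+m; <⇒≤; <⇒≱; ≰⇒>; ∸-mono; ∸-monoˡ-≤; m∸[m∸n]≡n)
open import Data.List using ([]; _∷_; _++_; map; reverse; concatMap)
open import Data.List.Properties
  using (++-assoc; ++-identityʳ; map-++; reverse-++; unfold-reverse; concatMap-++)
open import Data.Product using (_×_; ∃; _,_)
open import Data.Bool using (true; false)
open import Data.Empty using (⊥-elim)
open import Relation.Nullary using (yes; no)
open import Relation.Binary.PropositionalEquality
  using (_≡_; refl; sym; trans; cong; cong₂; subst; module ≡-Reasoning)

module _ {G : Set} where

  invL-involutive : ∀ (x : Letter G) → invL (invL x) ≡ x
  invL-involutive (g , true)  = refl
  invL-involutive (g , false) = refl

  invW-∷ : ∀ (x : Letter G) w → invW (x ∷ w) ≡ invW w ++ invL x ∷ []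
  invW-∷ x w = unfold-reverse (invL x) (map invL w)

  invW-++ : ∀ (u v : Word G) → invW (u ++ v) ≡ invW v ++ invW u
  invW-++ u v = trans (cong reverse (map-++ invL u v)) (reverse-++ (map invL u) (map invL v))

module _ {G : Set} {R : Word G → Word G → Set} where

  ≡⇒Eqv : ∀ {u v : Word G} → u ≡ v → Eqv R u v
  ≡⇒Eqv refl = refl'

  ++-congʳ : ∀ {u v} (w : Word G) → Eqv R u v → Eqv R (u ++ w) (v ++ w)
  ++-congʳ w = ctx [] w

  ++-congˡ : ∀ {u v} (w : Word G) → Eqv R u v → Eqv R (w ++ u) (w ++ v)
  ++-congˡ {u} {v} w u≈v =
    trans' (≡⇒Eqv (cong (w ++_) (sym (++-identityʳ u))))
      (trans' (ctx w [] u≈v) (≡⇒Eqv (cong (w ++_) (++-identityʳ v))))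

  ++-cong : ∀ {u u′ v v′} → Eqv R u u′ → Eqv R v v′ → Eqv R (u ++ v) (u′ ++ v′)
  ++-cong {u′ = u′} {v = v} u≈u′ v≈v′ = trans' (++-congʳ v u≈u′) (++-congˡ u′ v≈v′)

  invW-inverseʳ : ∀ (w : Word G) → Eqv R (w ++ invW w) []
  invW-inverseʳ []      = refl'
  invW-inverseʳ (x ∷ w) =
    trans' (≡⇒Eqv (cong (x ∷_) regroup))
      (trans' (ctx (x ∷ []) (invL x ∷ []) (invW-inverseʳ w)) (cancel x))
    where
    regroup : w ++ invW (x ∷ w) ≡ (w ++ invW w) ++ invL x ∷ []
    regroup = trans (cong (w ++_) (invW-∷ x w)) (sym (++-assoc w (invW w) _))

  invW-inverseˡ : ∀ (w : Word G) → Eqv R (invW w ++ w) []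
  invW-inverseˡ []      = refl'
  invW-inverseˡ (x ∷ w) =
    trans' (≡⇒Eqv regroup) (trans' (ctx (invW w) w cancel′) (invW-inverseˡ w))
    where
    cancel′ : Eqv R (invL x ∷ x ∷ []) []
    cancel′ = subst (λ y → Eqv R (invL x ∷ y ∷ []) []) (invL-involutive x) (cancel (invL x))
    regroup : invW (x ∷ w) ++ x ∷ w ≡ invW w ++ (invL x ∷ x ∷ []) ++ w
    regroup = trans (cong (_++ x ∷ w) (invW-∷ x w)) (++-assoc (invW w) (invL x ∷ []) (x ∷ w))

  ≈[]⇒invW≈[] : ∀ {w : Word G} → Eqv R w [] → Eqv R (invW w) []
  ≈[]⇒invW≈[] {w} w≈[] =
    trans' (≡⇒Eqv (sym (++-identityʳ (invW w))))
      (trans' (++-congˡ (invW w) (sym' w≈[])) (invW-inverseˡ w))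

module _ {G H : Set} {R : Word G → Word G → Set} {S : Word H → Word H → Set}
         (φ : Word G → Word H) (φ-++ : ∀ u v → φ (u ++ v) ≡ φ u ++ φ v) where

  Eqv-map : (∀ x → Eqv S (φ (x ∷ invL x ∷ [])) (φ [])) →
            (∀ {u v} → R u v → Eqv S (φ u) (φ v)) →
            ∀ {u v} → Eqv R u v → Eqv S (φ u) (φ v)
  Eqv-map φ-cancel φ-rel (rel r)         = φ-rel r
  Eqv-map φ-cancel φ-rel refl'           = refl'
  Eqv-map φ-cancel φ-rel (sym' e)        = sym' (Eqv-map φ-cancel φ-rel e)
  Eqv-map φ-cancel φ-rel (trans' e e′)   =
    trans' (Eqv-map φ-cancel φ-rel e) (Eqv-map φ-cancel φ-rel e′)
  Eqv-map φ-cancel φ-rel (cancel x)      = φ-cancel x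
  Eqv-map φ-cancel φ-rel (ctx a b {u} {v} e) =
    trans' (≡⇒Eqv (φ-++₃ u))
      (trans' (++-congˡ (φ a) (++-congʳ (φ b) (Eqv-map φ-cancel φ-rel e)))
        (≡⇒Eqv (sym (φ-++₃ v))))
    where
    φ-++₃ : ∀ w → φ (a ++ w ++ b) ≡ φ a ++ φ w ++ φ b
    φ-++₃ w = trans (φ-++ a (w ++ b)) (cong (φ a ++_) (φ-++ w b))

concatMap-invW : ∀ {G H : Set} (f : Letter G → Word H) →
                 (∀ x → f (invL x) ≡ invW (f x)) →
                 ∀ w → concatMap f (invW w) ≡ invW (concatMap f w)
concatMap-invW f f-invL []      = refl
concatMap-invW f f-invL (x ∷ w) = begin
  concatMap f (invW (x ∷ w))                       ≡⟨ cong (concatMap f) (invW-∷ x w) ⟩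
  concatMap f (invW w ++ invL x ∷ [])              ≡⟨ concatMap-++ f (invW w) (invL x ∷ []) ⟩
  concatMap f (invW w) ++ f (invL x) ++ []         ≡⟨ cong₂ _++_ (concatMap-invW f f-invL w)
                                                        (trans (++-identityʳ _) (f-invL x)) ⟩
  invW (concatMap f w) ++ invW (f x)               ≡⟨ invW-++ (f x) (concatMap f w) ⟨
  invW (concatMap f (x ∷ w))                       ∎
  where open ≡-Reasoning

[o∸m]∸[o∸n]≡n∸m : ∀ o m n → m ≤ n → n ≤ o → (o ∸ m) ∸ (o ∸ n) ≡ n ∸ m
[o∸m]∸[o∸n]≡n∸m o       zero    n       z≤n       n≤o       = m∸[m∸n]≡n n≤o
[o∸m]∸[o∸n]≡n∸m (suc o) (suc m) (suc n) (s≤s m≤n) (s≤s n≤o) = [o∸m]∸[o∸n]≡n∸m o m n m≤n n≤o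

module _ {n k : ℕ} where

  len-reflected : ∀ (a b c : Gen n k n) → q b ≤ q a →
                  p c ≡ (p a + q a) ∸ q b → q c ≡ (p a + q a) ∸ p b → len c ≡ len b
  len-reflected a b c qb≤qa pc≡ qc≡ = cong suc (trans (cong₂ _∸_ qc≡ pc≡)
    ([o∸m]∸[o∸n]≡n∸m (p a + q a) (p b) (q b) (<⇒≤ (p<q b)) (≤-trans qb≤qa (m≤n+m (q a) (p a)))))

  len-mono-⊆ : ∀ (a b : Gen n k n) → p a ≤ p b → q b ≤ q a → len b ≤ len a
  len-mono-⊆ a b pa≤pb qb≤qa = s≤s (∸-mono qb≤qa pa≤pb)

module Projection (n i : ℕ) where

  toLong : (g : GenJ n) → i ≤ len g → Gen n i n
  toLong g h = gen (p g) (q g) (1≤p g) (p<q g) (q≤n g) h (len≤j g)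

  ιG-toLong : ∀ (g : GenJ n) h → ιG (toLong g h) ≡ g
  ιG-toLong g h = cong (λ l → gen (p g) (q g) (1≤p g) (p<q g) (q≤n g) l (len≤j g)) (≤-irrelevant _ _)

  toLong-ιG : ∀ (g : Gen n i n) h → toLong (ιG g) h ≡ g
  toLong-ιG g h = cong (λ l → gen (p g) (q g) (1≤p g) (p<q g) (q≤n g) l (len≤j g)) (≤-irrelevant _ _)

  ε-++ : ∀ (u v : Word (GenJ n)) → ε i (u ++ v) ≡ ε i u ++ ε i v
  ε-++ = concatMap-++ (εL i)

  ε-invW : ∀ (w : Word (GenJ n)) → ε i (invW w) ≡ invW (ε i w)
  ε-invW = concatMap-invW (εL i) εL-invL
    where
    εL-invL : ∀ x → εL i (invL x) ≡ invW (εL i x)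
    εL-invL (g , b) with i ≤? len g
    ... | yes _ = refl
    ... | no  _ = refl

  ε-cancel : ∀ x → EqJ n i n (ε i (x ∷ invL x ∷ [])) []
  ε-cancel (g , b) with i ≤? len g
  ... | yes h = cancel (toLong g h , b)
  ... | no  _ = refl'

  ε-RelJ : ∀ {u v} → RelJ {n} {2} {n} u v → EqJ n i n (ε i u) (ε i v)
  ε-RelJ (j1 a) with i ≤? len a
  ... | yes h = rel (j1 (toLong a h))
  ... | no  _ = refl'
  ε-RelJ (j2 a b disj) with i ≤? len a | i ≤? len b
  ... | yes ha | yes hb = rel (j2 (toLong a ha) (toLong b hb) disj)
  ... | yes _  | no  _  = refl'
  ... | no  _  | yes _  = refl'
  ... | no  _  | no  _  = refl'
  ε-RelJ (j3 a b c pa≤pb qb≤qa pc≡ qc≡) with i ≤? len a | i ≤? len b | i ≤? len c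
  ... | yes ha | yes hb | yes hc = rel (j3 (toLong a ha) (toLong b hb) (toLong c hc) pa≤pb qb≤qa pc≡ qc≡)
  ... | yes _  | no  _  | no  _  = refl'
  ... | no  _  | no  _  | no  _  = refl'
  ... | _      | yes hb | no ¬hc = ⊥-elim (¬hc (subst (i ≤_) (sym (len-reflected a b c qb≤qa pc≡ qc≡)) hb))
  ... | _      | no ¬hb | yes hc = ⊥-elim (¬hb (subst (i ≤_) (len-reflected a b c qb≤qa pc≡ qc≡) hc))
  ... | no ¬ha | yes hb | yes _  = ⊥-elim (¬ha (≤-trans hb (len-mono-⊆ a b pa≤pb qb≤qa)))

  ε-cong : ∀ {u v} → EqJn n u v → EqJ n i n (ε i u) (ε i v)
  ε-cong = Eqv-map (ε i) ε-++ ε-cancel ε-RelJ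

  ι-++ : ∀ (u v : Word (Gen n i n)) → ι (u ++ v) ≡ ι u ++ ι v
  ι-++ = map-++ _

  ι-RelJ : ∀ {u v} → RelJ {n} {i} {n} u v → EqJn n (ι u) (ι v)
  ι-RelJ (j1 a)             = rel (j1 (ιG a))
  ι-RelJ (j2 a b disj)      = rel (j2 (ιG a) (ιG b) disj)
  ι-RelJ (j3 a b c x y z w) = rel (j3 (ιG a) (ιG b) (ιG c) x y z w)

  ι-cong : ∀ {u v} → EqJ n i n u v → EqJn n (ι u) (ι v)
  ι-cong = Eqv-map ι ι-++ (λ { (g , b) → cancel (ιG g , b) }) ι-RelJ

  ε∘ι≡id : ∀ (w : Word (Gen n i n)) → ε i (ι w) ≡ w
  ε∘ι≡id []            = refl
  ε∘ι≡id ((g , b) ∷ w) with i ≤? len g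
  ... | yes h  = cong₂ (λ g′ w′ → (g′ , b) ∷ w′) (toLong-ιG g h) (ε∘ι≡id w)
  ... | no ¬h  = ⊥-elim (¬h (i≤len g))

  NC-short : ∀ (g : GenJ n) b → len g ≤ i ∸ 1 → NC n i ((g , b) ∷ [])
  NC-short g true  short = nc-gen g short
  NC-short g false short = nc-inv (nc-gen g short)

  w·ιεw⁻¹∈N : ∀ (w : Word (GenJ n)) → NC n i (w ++ invW (ι (ε i w)))
  w·ιεw⁻¹∈N []            = nc-one
  w·ιεw⁻¹∈N ((g , b) ∷ w) with i ≤? len g
  ... | yes h = subst (NC n i) conjugate (nc-conj ((g , b) ∷ []) (w·ιεw⁻¹∈N w))
    where
    conjugate : (g , b) ∷ (w ++ invW (ι (ε i w))) ++ invW ((g , b) ∷ [])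
              ≡ (g , b) ∷ w ++ invW ((ιG (toLong g h) , b) ∷ ι (ε i w))
    conjugate = cong ((g , b) ∷_) (trans (++-assoc w _ _) (cong (w ++_) (sym (begin
      invW ((ιG (toLong g h) , b) ∷ ι (ε i w)) ≡⟨ cong (λ g′ → invW ((g′ , b) ∷ ι (ε i w))) (ιG-toLong g h) ⟩
      invW ((g , b) ∷ ι (ε i w))               ≡⟨ invW-∷ (g , b) (ι (ε i w)) ⟩
      invW (ι (ε i w)) ++ invW ((g , b) ∷ [])  ∎))))
      where open ≡-Reasoning
  ... | no ¬h = nc-mul (NC-short g b (∸-monoˡ-≤ 1 (≰⇒> ¬h))) (w·ιεw⁻¹∈N w)

  ker⊆N : ∀ w → EqJ n i n (ε i w) [] → NC n i w
  ker⊆N w εw≈[] = nc-resp w·ιεw⁻¹≈w (w·ιεw⁻¹∈N w)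
    where
    w·ιεw⁻¹≈w : EqJn n (w ++ invW (ι (ε i w))) w
    w·ιεw⁻¹≈w = trans' (++-congˡ w (≈[]⇒invW≈[] (ι-cong εw≈[]))) (≡⇒Eqv (++-identityʳ w))

  N⊆ker : 2 ≤ i → ∀ {w} → NC n i w → EqJ n i n (ε i w) []
  N⊆ker (s≤s (s≤s _)) (nc-gen g short) with i ≤? len g
  ... | yes long = ⊥-elim (<⇒≱ (s≤s short) long)
  ... | no  _    = refl'
  N⊆ker 2≤i nc-one = refl'
  N⊆ker 2≤i (nc-mul {u} {v} u∈N v∈N) =
    trans' (≡⇒Eqv (ε-++ u v)) (++-cong (N⊆ker 2≤i u∈N) (N⊆ker 2≤i v∈N))
  N⊆ker 2≤i (nc-inv {u} u∈N) = trans' (≡⇒Eqv (ε-invW u)) (≈[]⇒invW≈[] (N⊆ker 2≤i u∈N))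
  N⊆ker 2≤i (nc-conj {u} w u∈N) =
    trans' (≡⇒Eqv distribute)
      (trans' (++-congˡ (ε i w) (++-congʳ (invW (ε i w)) (N⊆ker 2≤i u∈N))) (invW-inverseʳ (ε i w)))
    where
    distribute : ε i (w ++ u ++ invW w) ≡ ε i w ++ ε i u ++ invW (ε i w)
    distribute = trans (ε-++ w (u ++ invW w))
      (cong (ε i w ++_) (trans (ε-++ u (invW w)) (cong (ε i u ++_) (ε-invW w))))
  N⊆ker 2≤i (nc-resp u≈v u∈N) = trans' (sym' (ε-cong u≈v)) (N⊆ker 2≤i u∈N)

proposition3p12 : ∀ (n i : ℕ) → 2 ≤ i → i ≤ n →
      -- ε_i is well defined on J_n
      (∀ (u v : Word (GenJ n)) → EqJn n u v → EqJ n i n (ε i u) (ε i v))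
      -- ε_i is a homomorphism
    × (∀ (u v : Word (GenJ n)) → EqJ n i n (ε i (u ++ v)) (ε i u ++ ε i v))
      -- ε_i is surjective
    × (∀ (w : Word (Gen n i n)) → ∃ λ (u : Word (GenJ n)) → EqJ n i n (ε i u) w)
      -- ι_i is a well-defined homomorphism J_n^{i,n} → J_n
    × (∀ (u v : Word (Gen n i n)) → EqJ n i n u v → EqJn n (ι u) (ι v))
    × (∀ (u v : Word (Gen n i n)) → EqJn n (ι (u ++ v)) (ι u ++ ι v))
      -- ι_i is a section of ε_i
    × (∀ (w : Word (Gen n i n)) → EqJ n i n (ε i (ι w)) w)
      -- ker ε_i = N
    × (∀ (w : Word (GenJ n)) → (EqJ n i n (ε i w) [] → NC n i w) × (NC n i w → EqJ n i n (ε i w) []))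
proposition3p12 n i 2≤i _ =
    (λ _ _ → ε-cong)
  , (λ u v → ≡⇒Eqv (ε-++ u v))
  , (λ w → ι w , ≡⇒Eqv (ε∘ι≡id w))
  , (λ _ _ → ι-cong)
  , (λ u v → ≡⇒Eqv (ι-++ u v))
  , (λ w → ≡⇒Eqv (ε∘ι≡id w))
  , (λ w → ker⊆N w , N⊆ker 2≤i)
  where open Projection n i
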